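{- Let $S=\{i_1<\cdots<i_s\}$ be an admissible set. Suppose $p(n)$ and $p_B(n)$ are polynomials such that $\#P(S,n)=p(n)2^{n-s-1}$ and $\#P_B(S,n)=p_B(n)2^{2n-s-1}$ for every $n$ for which $S$ is $n$-admissible. Then $p(n)=p_B(n)$; that is, the same polynomial in $n$ (depending on $S$) works for both the symmetric group $S_n$ and the hyperoctahedral group $B_n$.
   Context: $S_n$ is the symmetric group of permutations $\pi=\pi_1\cdots\pi_n$ of $\{1,\dots,n\}$. For $n\ge1$, $B_n$ is the set of signed permutations $\pi=\pi_1\cdots\pi_n$: words with each $\pi_i\in\{ -n,\dots,-1,1,\dots,n\}$ and $\{|\pi_1|,\dots,|\pi_n|\}=\{1,\dots,n\}$. For a (signed) permutation, an index $i\in\{2,\dots,n-1\}$ is a peak if $\pi_{i-1}<\pi_i>\pi_{i+1}$. $P(S,n)$ is the set of $\pi\in S_n$ whose peak set equals $S$, and $P_B(S,n)$ the set of $\pi\in B_n$ whose peak set equals $S$. $S$ is $n$-admissible if $\#P_B(S,n)\ne0$ (equivalently $\#P(S,n)\neq 0$: $S\subseteq\{2,\dots,n-1\}$ contains no two consecutive integers); $S$ is admissible if it is $n$-admissible for some $n$. (By Billey–Burdzy–Sagan such a polynomial $p$ exists for $S_n$.) -}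

module Defs where

open import Data.Nat as ℕ using (ℕ; zero; suc; _∸_)
open import Data.Integer as ℤ using (ℤ; +_; -[1+_]; ∣_∣)
open import Data.Integer.Properties as ℤP using ()
open import Data.Rational as ℚ using (ℚ; _/_)
open import Data.List using (List; []; _∷_; map; concatMap; filter; length; upTo; _++_)
open import Data.List.Relation.Unary.Unique.Propositional using (Unique)
import Data.List.Relation.Unary.Unique.DecPropositional as UDec
open import Data.List.Properties using (≡-dec)
open import Data.Nat.Properties as ℕP using ()
open import Data.Product using (Σ; _×_)
open import Relation.Binary.PropositionalEquality using (_≡_)
open import Relation.Nullary using (¬_; _×-dec_; Dec; does)
open import Data.Bool using (Bool; true; false; _∧_; if_then_else_)

words : {A : Set} → List A → ℕ → List (List A)
words alph zero    = [] ∷ []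
words alph (suc k) = concatMap (λ a → map (a ∷_) (words alph k)) alph

-- Peak set of a word π = π₁ ⋯ πₙ (positions 1-based), listed in increasing order:
-- i ∈ {2,…,n-1} is a peak iff π_{i-1} < π_i > π_{i+1}.
-- peaksFrom k w : the peaks of w, where the first letter of w sits at position k.
peaksFrom : ℕ → List ℤ → List ℕ
peaksFrom k (a ∷ rest@(b ∷ c ∷ _)) =
  if does (a ℤP.<? b) ∧ does (c ℤP.<? b)
  then suc k ∷ peaksFrom (suc k) rest
  else peaksFrom (suc k) rest
peaksFrom k _ = []

peakSet : List ℤ → List ℕ
peakSet π = peaksFrom 1 π

pos : ℕ → List ℤ
pos n = map (λ i → + suc i) (upTo n)

neg : ℕ → List ℤ
neg n = map (λ i → -[1+ i ]) (upTo n)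

Sym : ℕ → List (List ℤ)
Sym n = filter (UDec.unique? ℤP._≟_) (words (pos n) n)

-- B_n : words π₁⋯πₙ over {-n,…,-1,1,…,n} whose absolute values are pairwise
-- distinct (hence {|π₁|,…,|πₙ|} = {1,…,n}).
Hyp : ℕ → List (List ℤ)
Hyp n = filter (λ π → UDec.unique? ℕP._≟_ (map ∣_∣ π)) (words (neg n ++ pos n) n)

-- The set S ⊆ ℕ is represented by the list of its elements in increasing order.
-- #P(S,n) and #P_B(S,n)
#P : List ℕ → ℕ → ℕ
#P S n = length (filter (λ π → ≡-dec ℕP._≟_ (peakSet π) S) (Sym n))

#PB : List ℕ → ℕ → ℕ
#PB S n = length (filter (λ π → ≡-dec ℕP._≟_ (peakSet π) S) (Hyp n))

-- S is n-admissible (n ≥ 1, since B_n is defined for n ≥ 1)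
nAdmissible : List ℕ → ℕ → Set
nAdmissible S n = (1 ℕ.≤ n) × ¬ (#PB S n ≡ 0)

Admissible : List ℕ → Set
Admissible S = Σ ℕ (λ n → nAdmissible S n)

-- Polynomials with rational coefficients: coefficient lists c₀ ∷ c₁ ∷ ⋯ (constant term first).
Poly : Set
Poly = List ℚ

eval : Poly → ℚ → ℚ
eval []       x = ℚ.0ℚ
eval (c ∷ cs) x = c ℚ.+ x ℚ.* eval cs x

toℚ : ℕ → ℚ
toℚ m = (+ m) / 1

-- The core is #P_B(S,n) = 2ⁿ · #P(S,n). Sort the signed permutations by their sign vector ε ∈ {±}ⁿ: those with
-- sign vector ε are exactly the permutations of the n-letter alphabet {±1, …, ±n} carrying the signs ε, and the
-- order isomorphism of that alphabet onto {1, …, n} preserves peak sets. Admissibility passes from n to n + 1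
-- (append the new maximum n + 1, which creates no peak), so for all large n both hypotheses apply and give
-- 2ⁿ · p(n) · 2^(n−s−1) = p_B(n) · 2^(2n−s−1), i.e. p(n) = p_B(n); polynomials agreeing at infinitely many
-- points are equal.

module Submission where

open import Defs
open import Data.Bool using (true; false; if_then_else_; _∧_)
open import Data.Bool.Properties using (∧-zeroʳ)
open import Data.Empty using (⊥; ⊥-elim)
open import Data.Integer as ℤ using (ℤ; -[1+_]; ∣_∣; sign; _◃_)
import Data.Integer.Properties as ℤP
open import Data.List using (List; []; _∷_; [_]; _++_; map; concatMap; filter; length; upTo; applyDownFrom)
open import Data.List.Properties as List using (≡-dec; filter-accept; filter-reject)
open import Data.List.Membership.Propositional using (_∈_; _∉_; find; lose)
open import Data.List.Membership.Propositional.Properties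
open import Data.List.Relation.Binary.Subset.Propositional using (_⊆_)
open import Data.List.Relation.Unary.All as All using (All; []; _∷_)
import Data.List.Relation.Unary.All.Properties as AllP
open import Data.List.Relation.Unary.Any using (here; there)
open import Data.List.Relation.Unary.AllPairs as AllPairs using (AllPairs; []; _∷_)
import Data.List.Relation.Unary.AllPairs.Properties as AllPairsP
open import Data.List.Relation.Unary.Unique.Propositional using (Unique)
import Data.List.Relation.Unary.Unique.Propositional.Properties as Unique
import Data.List.Relation.Unary.Unique.DecPropositional as UniqueDec
open import Data.Nat as ℕ using (ℕ; zero; suc; _+_; _*_; _^_; _∸_; _≤_; _<_; z≤n; s≤s)
import Data.Nat.Properties as ℕP
open import Data.Nat.ListAction using (sum)
open import Data.Sign as Sign using (Sign)
open import Data.Rational as ℚ using (ℚ; 0ℚ; 1/_)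
import Data.Rational.Properties as ℚP
import Data.Rational.Unnormalised as ℚᵘ
import Data.Rational.Unnormalised.Properties as ℚᵘP
open import Data.Rational.Solver using (module +-*-Solver)
open import Algebra.Properties.Group ℚP.+-0-group using (x∙y⁻¹≈ε⇒x≈y)
open import Data.Product using (∃-syntax; _×_; _,_; proj₁; proj₂)
open import Data.Sum using (_⊎_; inj₁; inj₂)
open import Function using (id; flip; _∘_; _⇔_; Equivalence; mk⇔)
open import Level using (0ℓ)
open import Relation.Binary using (DecidableEquality; tri<; tri≈; tri>)
open import Relation.Binary.PropositionalEquality hiding ([_])
open import Relation.Nullary using (yes; no; does; contradiction)
open import Relation.Nullary.Decidable using (dec-true; dec-false; does-⇔)
open import Relation.Unary using (Pred; Decidable)

private variable
  X Y : Set

filter-map : {P : Pred Y 0ℓ} {Q : Pred X 0ℓ} (P? : Decidable P) (Q? : Decidable Q) (f : X → Y) (xs : List X) →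
  (∀ {x} → x ∈ xs → P (f x) ⇔ Q x) → filter P? (map f xs) ≡ map f (filter Q? xs)
filter-map P? Q? f [] _ = refl
filter-map P? Q? f (x ∷ xs) P⇔Q with Q? x
... | yes q = trans (filter-accept P? (Equivalence.from (P⇔Q (here refl)) q))
                    (cong (f x ∷_) (filter-map P? Q? f xs (P⇔Q ∘ there)))
... | no ¬q = trans (filter-reject P? (¬q ∘ Equivalence.to (P⇔Q (here refl))))
                    (filter-map P? Q? f xs (P⇔Q ∘ there))

unique-⊆⇒length≤ : {xs ys : List X} → Unique xs → xs ⊆ ys → length xs ≤ length ys
unique-⊆⇒length≤ {xs = []} _ _ = z≤n
unique-⊆⇒length≤ {xs = x ∷ xs} (x∉xs ∷ !xs) xs⊆ys with ys₁ , ys₂ , refl ← ∈-∃++ (xs⊆ys (here refl)) =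
  ℕP.≤-trans (s≤s (unique-⊆⇒length≤ !xs xs⊆ys₁ys₂)) (ℕP.≤-reflexive (sym (List.length-++-sucʳ ys₁ x ys₂)))
  where
  xs⊆ys₁ys₂ : xs ⊆ ys₁ ++ ys₂
  xs⊆ys₁ys₂ z∈xs with ∈-++⁻ ys₁ (xs⊆ys (there z∈xs))
  ... | inj₁ z∈ys₁           = ∈-++⁺ˡ z∈ys₁
  ... | inj₂ (here refl)     = ⊥-elim (All.lookup x∉xs z∈xs refl)
  ... | inj₂ (there z∈ys₂)   = ∈-++⁺ʳ ys₁ z∈ys₂

unique-⊆-length≥⇒⊇ : DecidableEquality X → {xs ys : List X} →
                     Unique xs → xs ⊆ ys → length ys ≤ length xs → ys ⊆ xs
unique-⊆-length≥⇒⊇ _≟_ {xs} {ys} !xs xs⊆ys |ys|≤|xs| {y} y∈ys with y ∈? xs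
  where open import Data.List.Membership.DecPropositional _≟_ using (_∈?_)
... | yes y∈xs = y∈xs
... | no  y∉xs = contradiction (ℕP.≤-trans (unique-⊆⇒length≤ !yxs yxs⊆ys) |ys|≤|xs|) (ℕP.<-irrefl refl)
  where
  !yxs : Unique (y ∷ xs)
  !yxs = All.tabulate (λ z∈xs y≡z → y∉xs (subst (_∈ xs) (sym y≡z) z∈xs)) ∷ !xs
  yxs⊆ys : y ∷ xs ⊆ ys
  yxs⊆ys (here refl) = y∈ys
  yxs⊆ys (there z∈xs) = xs⊆ys z∈xs

unique-map⁺ : {alph : List X} {f : X → Y} → (∀ {x y} → x ∈ alph → y ∈ alph → x ≢ y → f x ≢ f y) →
              ∀ {w} → All (_∈ alph) w → Unique w → Unique (map f w)
unique-map⁺ f-inj [] [] = []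
unique-map⁺ f-inj (x∈ ∷ w⊆) (x∉w ∷ !w) =
  AllP.map⁺ (All.zipWith (λ (y∈ , x≢y) → f-inj x∈ y∈ x≢y) (w⊆ , x∉w)) ∷ unique-map⁺ f-inj w⊆ !w

applyDownFrom-cong : ∀ {f g : ℕ → X} {n} → (∀ {k} → k < n → f k ≡ g k) → applyDownFrom f n ≡ applyDownFrom g n
applyDownFrom-cong {n = zero} _ = refl
applyDownFrom-cong {n = suc n} f≡g = cong₂ _∷_ (f≡g ℕP.≤-refl) (applyDownFrom-cong (f≡g ∘ ℕP.m≤n⇒m≤1+n))

length≢0-map⊆ : (f : X → Y) {xs : List X} {ys : List Y} →
                (∀ {x} → x ∈ xs → f x ∈ ys) → length xs ≢ 0 → length ys ≢ 0
length≢0-map⊆ f {[]} _ |xs|≢0 = contradiction refl |xs|≢0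
length≢0-map⊆ f {x ∷ xs} {[]} f⊆ _ with () ← f⊆ (here refl)
length≢0-map⊆ f {x ∷ xs} {_ ∷ _} f⊆ _ ()

module _ (c : X → Y) (_≟_ : DecidableEquality Y) where

  fibre : Y → List X → List X
  fibre y = filter (λ x → c x ≟ y)

  private
    hits : X → Y → ℕ
    hits x y = if does (c x ≟ y) then 1 else 0

    length-fibre-∷ : ∀ x xs y → length (fibre y (x ∷ xs)) ≡ hits x y + length (fibre y xs)
    length-fibre-∷ x xs y with does (c x ≟ y)
    ... | true  = refl
    ... | false = refl

    sum-hits-∉ : ∀ x {ys} → c x ∉ ys → sum (map (hits x) ys) ≡ 0
    sum-hits-∉ x {[]} _ = refl
    sum-hits-∉ x {y ∷ ys} cx∉ rewrite dec-false (c x ≟ y) (cx∉ ∘ here) = sum-hits-∉ x (cx∉ ∘ there)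

    sum-hits-∈ : ∀ x {ys} → Unique ys → c x ∈ ys → sum (map (hits x) ys) ≡ 1
    sum-hits-∈ x (y∉ys ∷ _) (here refl) rewrite dec-true (c x ≟ c x) refl =
      cong suc (sum-hits-∉ x λ cx∈ys → All.lookup y∉ys cx∈ys refl)
    sum-hits-∈ x {y ∷ ys} (y∉ys ∷ !ys) (there cx∈ys)
      rewrite dec-false (c x ≟ y) (λ cx≡y → All.lookup y∉ys cx∈ys (sym cx≡y)) = sum-hits-∈ x !ys cx∈ys

    sum-map-+ : (f g : Y → ℕ) (ys : List Y) → sum (map (λ y → f y + g y) ys) ≡ sum (map f ys) + sum (map g ys)
    sum-map-+ f g [] = refl
    sum-map-+ f g (y ∷ ys) = trans (cong ((f y + g y) +_) (sum-map-+ f g ys)) (interchange (f y) (g y) _ _)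
      where open import Algebra.Properties.CommutativeSemigroup ℕP.+-commutativeSemigroup using (interchange)

  length≡sum-fibres : {ys : List Y} → Unique ys → (xs : List X) → All (λ x → c x ∈ ys) xs →
                      length xs ≡ sum (map (λ y → length (fibre y xs)) ys)
  length≡sum-fibres {ys} !ys [] [] = sym (sum-zeros ys)
    where
    sum-zeros : (ys : List Y) → sum (map (λ y → length (fibre y [])) ys) ≡ 0
    sum-zeros [] = refl
    sum-zeros (_ ∷ ys) = sum-zeros ys
  length≡sum-fibres {ys} !ys (x ∷ xs) (cx∈ys ∷ cxs∈ys) = begin
    suc (length xs)
      ≡⟨ cong₂ _+_ (sym (sum-hits-∈ x !ys cx∈ys)) (length≡sum-fibres !ys xs cxs∈ys) ⟩
    sum (map (hits x) ys) + sum (map (λ y → length (fibre y xs)) ys)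
      ≡⟨ sym (sum-map-+ (hits x) _ ys) ⟩
    sum (map (λ y → hits x y + length (fibre y xs)) ys)
      ≡⟨ cong sum (List.map-cong (sym ∘ length-fibre-∷ x xs) ys) ⟩
    sum (map (λ y → length (fibre y (x ∷ xs))) ys) ∎
    where open ≡-Reasoning

  length≡length*fibre : {ys : List Y} → Unique ys → (xs : List X) → All (λ x → c x ∈ ys) xs →
                        (m : ℕ) → (∀ {y} → y ∈ ys → length (fibre y xs) ≡ m) → length xs ≡ length ys * m
  length≡length*fibre {ys} !ys xs cxs∈ys m |fibre|≡m =
    trans (length≡sum-fibres !ys xs cxs∈ys) (sum-const ys |fibre|≡m)
    where
    sum-const : (zs : List Y) → (∀ {y} → y ∈ zs → length (fibre y xs) ≡ m) →
                sum (map (λ y → length (fibre y xs)) zs) ≡ length zs * m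
    sum-const [] _ = refl
    sum-const (z ∷ zs) h = cong₂ _+_ (h (here refl)) (sum-const zs (h ∘ there))

-- Words over an alphabet

private
  prefixEach : List X → List (List X) → List (List X)
  prefixEach as ws = concatMap (λ a → map (a ∷_) ws) as

  ∈-prefixEach⁻ : ∀ as ws {w : List X} → w ∈ prefixEach as ws →
                  ∃[ a ] ∃[ w′ ] (w ≡ a ∷ w′ × a ∈ as × w′ ∈ ws)
  ∈-prefixEach⁻ as ws w∈ with a , a∈as , w∈aws ← find (∈-concatMap⁻ _ {xs = as} w∈)
                          with w′ , w′∈ws , refl ← ∈-map⁻ (a ∷_) w∈aws = a , w′ , refl , a∈as , w′∈ws

  ∈-prefixEach⁺ : ∀ as ws {a : X} {w′} → a ∈ as → w′ ∈ ws → a ∷ w′ ∈ prefixEach as ws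
  ∈-prefixEach⁺ as ws a∈as w′∈ws = ∈-concatMap⁺ _ {xs = as} (lose a∈as (∈-map⁺ _ w′∈ws))

  length-prefixEach : ∀ as (ws : List (List X)) → length (prefixEach as ws) ≡ length as * length ws
  length-prefixEach [] ws = refl
  length-prefixEach (a ∷ as) ws =
    trans (List.length-++ (map (a ∷_) ws)) (cong₂ _+_ (List.length-map (a ∷_) ws) (length-prefixEach as ws))

  prefixEach-unique : ∀ {as} {ws : List (List X)} → Unique as → Unique ws → Unique (prefixEach as ws)
  prefixEach-unique {as = []} _ _ = []
  prefixEach-unique {as = a ∷ as} {ws} (a∉as ∷ !as) !ws =
    Unique.++⁺ (Unique.map⁺ List.∷-injectiveʳ !ws) (prefixEach-unique !as !ws) disjoint
    where
    disjoint : ∀ {v} → v ∈ map (a ∷_) ws × v ∈ prefixEach as ws → ⊥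
    disjoint (v∈aws , v∈rest) with _ , _ , refl ← ∈-map⁻ (a ∷_) v∈aws
                              with _ , _ , refl , a∈as , _ ← ∈-prefixEach⁻ as ws v∈rest = All.lookup a∉as a∈as refl

  prefixEach-map : ∀ (f : X → Y) as ws → prefixEach (map f as) (map (map f) ws) ≡ map (map f) (prefixEach as ws)
  prefixEach-map f [] ws = refl
  prefixEach-map f (a ∷ as) ws = begin
    map (f a ∷_) (map (map f) ws) ++ prefixEach (map f as) (map (map f) ws)
      ≡⟨ cong₂ _++_ (trans (sym (List.map-∘ ws)) (List.map-∘ ws)) (prefixEach-map f as ws) ⟩
    map (map f) (map (a ∷_) ws) ++ map (map f) (prefixEach as ws)
      ≡⟨ sym (List.map-++ (map f) (map (a ∷_) ws) _) ⟩
    map (map f) (prefixEach (a ∷ as) ws) ∎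
    where open ≡-Reasoning

module _ {alph : List X} where

  ∈-words⁻ : ∀ k {w} → w ∈ words alph k → length w ≡ k × All (_∈ alph) w
  ∈-words⁻ zero (here refl) = refl , []
  ∈-words⁻ (suc k) w∈ with a , w′ , refl , a∈ , w′∈ ← ∈-prefixEach⁻ alph (words alph k) w∈
                      with refl , w′⊆alph ← ∈-words⁻ k w′∈ = refl , a∈ ∷ w′⊆alph

  ∈-words⁺ : ∀ {w} → All (_∈ alph) w → w ∈ words alph (length w)
  ∈-words⁺ [] = here refl
  ∈-words⁺ (a∈ ∷ w⊆alph) = ∈-prefixEach⁺ alph _ a∈ (∈-words⁺ w⊆alph)

  length-words : ∀ k → length (words alph k) ≡ length alph ^ k
  length-words zero = refl
  length-words (suc k) = trans (length-prefixEach alph _) (cong (length alph *_) (length-words k))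

  words-unique : Unique alph → ∀ k → Unique (words alph k)
  words-unique !alph zero = [] ∷ []
  words-unique !alph (suc k) = prefixEach-unique !alph (words-unique !alph k)

words-map : ∀ (f : X → Y) alph k → words (map f alph) k ≡ map (map f) (words alph k)
words-map f alph zero = refl
words-map f alph (suc k) = trans (cong (prefixEach (map f alph)) (words-map f alph k)) (prefixEach-map f alph _)

peaksFrom-map : (f : ℤ → ℤ) {alph : List ℤ} → (∀ {x y} → x ∈ alph → y ∈ alph → f x ℤ.< f y ⇔ x ℤ.< y) →
                ∀ k {w} → All (_∈ alph) w → peaksFrom k (map f w) ≡ peaksFrom k w
peaksFrom-map f f-<⇔ k {a ∷ b ∷ c ∷ w} (a∈ ∷ b∈ ∷ c∈ ∷ w⊆) =
  cong₂ (λ isPeak ps → if isPeak then suc k ∷ ps else ps)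
        (cong₂ _∧_ (does-⇔ (f-<⇔ a∈ b∈) (f a ℤ.<? f b) (a ℤ.<? b))
                    (does-⇔ (f-<⇔ c∈ b∈) (f c ℤ.<? f b) (c ℤ.<? b)))
        (peaksFrom-map f f-<⇔ (suc k) (b∈ ∷ c∈ ∷ w⊆))
peaksFrom-map f f-<⇔ k {[]} _ = refl
peaksFrom-map f f-<⇔ k {_ ∷ []} _ = refl
peaksFrom-map f f-<⇔ k {_ ∷ _ ∷ []} _ = refl

peaksFrom-∷ʳ-max : ∀ m k w → All (ℤ._< m) w → peaksFrom k (w ++ [ m ]) ≡ peaksFrom k w
peaksFrom-∷ʳ-max m k (a ∷ b ∷ c ∷ w) (_ ∷ b<m ∷ c<m ∷ w<m) =
  cong (λ ps → if does (a ℤ.<? b) ∧ does (c ℤ.<? b) then suc k ∷ ps else ps)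
       (peaksFrom-∷ʳ-max m (suc k) (b ∷ c ∷ w) (b<m ∷ c<m ∷ w<m))
peaksFrom-∷ʳ-max m k (a ∷ b ∷ []) (_ ∷ b<m ∷ [])
  rewrite dec-false (m ℤ.<? b) (ℤP.<-asym b<m) | ∧-zeroʳ (does (a ℤ.<? b)) = refl
peaksFrom-∷ʳ-max m k [] _ = refl
peaksFrom-∷ʳ-max m k (_ ∷ []) _ = refl

-- Relabelling an ordered alphabet

Sorted : List ℤ → Set
Sorted = AllPairs ℤ._<_

relabel : List ℤ → List ℤ → ℤ → ℤ
relabel (a ∷ as) (b ∷ bs) x = if does (x ℤ.≟ a) then b else relabel as bs x
relabel _        _        x = x

private
  relabel-head : ∀ a as b bs → relabel (a ∷ as) (b ∷ bs) a ≡ b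
  relabel-head a as b bs rewrite dec-true (a ℤ.≟ a) refl = refl

  relabel-tail : ∀ {a x} as b bs → a ℤ.< x → relabel (a ∷ as) (b ∷ bs) x ≡ relabel as bs x
  relabel-tail {a} {x} _ _ _ a<x rewrite dec-false (x ℤ.≟ a) (ℤP.<⇒≢ a<x ∘ sym) = refl

map-relabel : ∀ {as bs} → Sorted as → length as ≡ length bs → map (relabel as bs) as ≡ bs
map-relabel {[]} {[]} _ _ = refl
map-relabel {a ∷ as} {b ∷ bs} (a<as ∷ as↑) |as|≡|bs| =
  cong₂ _∷_ (relabel-head a as b bs)
        (trans (List.map-cong-local (All.map (relabel-tail as b bs) a<as)) (map-relabel as↑ (ℕP.suc-injective |as|≡|bs|)))

relabel-∈ : ∀ {as bs} → Sorted as → length as ≡ length bs → ∀ {x} → x ∈ as → relabel as bs x ∈ bs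
relabel-∈ {as} {bs} as↑ |as|≡|bs| {x} x∈as =
  subst (relabel as bs x ∈_) (map-relabel as↑ |as|≡|bs|) (∈-map⁺ (relabel as bs) x∈as)

relabel-<-mono : ∀ {as bs} → Sorted as → Sorted bs → length as ≡ length bs →
                 ∀ {x y} → x ∈ as → y ∈ as → x ℤ.< y → relabel as bs x ℤ.< relabel as bs y
relabel-<-mono {a ∷ as} {b ∷ bs} (a<as ∷ as↑) (b<bs ∷ bs↑) |as|≡|bs| {x} {y} = go
  where
  |as|≡|bs|′ = ℕP.suc-injective |as|≡|bs|
  go : x ∈ a ∷ as → y ∈ a ∷ as → x ℤ.< y → relabel (a ∷ as) (b ∷ bs) x ℤ.< relabel (a ∷ as) (b ∷ bs) y
  go (here refl) (here refl) x<x = contradiction x<x (ℤP.<-irrefl refl)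
  go (here refl) (there y∈as) x<y rewrite relabel-head a as b bs | relabel-tail as b bs x<y =
    All.lookup b<bs (relabel-∈ as↑ |as|≡|bs|′ y∈as)
  go (there x∈as) (here refl) x<y = contradiction (All.lookup a<as x∈as) (ℤP.<-asym x<y)
  go (there x∈as) (there y∈as) x<y
    rewrite relabel-tail as b bs (All.lookup a<as x∈as) | relabel-tail as b bs (All.lookup a<as y∈as) =
    relabel-<-mono as↑ bs↑ |as|≡|bs|′ x∈as y∈as x<y

module _ {as bs : List ℤ} (as↑ : Sorted as) (bs↑ : Sorted bs) (|as|≡|bs| : length as ≡ length bs) where

  private
    f = relabel as bs
    f-mono = relabel-<-mono as↑ bs↑ |as|≡|bs|

  relabel-<⇔ : ∀ {x y} → x ∈ as → y ∈ as → f x ℤ.< f y ⇔ x ℤ.< y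
  relabel-<⇔ {x} {y} x∈ y∈ = mk⇔ reflect (f-mono x∈ y∈)
    where
    reflect : f x ℤ.< f y → x ℤ.< y
    reflect fx<fy with ℤP.<-cmp x y
    ... | tri< x<y _ _ = x<y
    ... | tri≈ _ refl _ = contradiction fx<fy (ℤP.<-irrefl refl)
    ... | tri> _ _ y<x = contradiction fx<fy (ℤP.<-asym (f-mono y∈ x∈ y<x))

  relabel-≢ : ∀ {x y} → x ∈ as → y ∈ as → x ≢ y → f x ≢ f y
  relabel-≢ {x} {y} x∈ y∈ x≢y fx≡fy with ℤP.<-cmp x y
  ... | tri< x<y _ _ = ℤP.<-irrefl fx≡fy (f-mono x∈ y∈ x<y)
  ... | tri≈ _ x≡y _ = x≢y x≡y
  ... | tri> _ _ y<x = ℤP.<-irrefl (sym fx≡fy) (f-mono y∈ x∈ y<x)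

hasPeakSet? : (S : List ℕ) → Decidable (λ π → peakSet π ≡ S)
hasPeakSet? S π = ≡-dec ℕP._≟_ (peakSet π) S

-- #P S n is by definition length (peakWords S (pos n) n).
peakWords : List ℕ → List ℤ → ℕ → List (List ℤ)
peakWords S alph k = filter (hasPeakSet? S) (filter (UniqueDec.unique? ℤP._≟_) (words alph k))

length-peakWords-relabel : ∀ S {as bs} → Sorted as → Sorted bs → length as ≡ length bs →
                           ∀ k → length (peakWords S bs k) ≡ length (peakWords S as k)
length-peakWords-relabel S {as} {bs} as↑ bs↑ |as|≡|bs| k = begin
  length (filter hasPeaks (filter unique? (words bs k)))
    ≡⟨ cong (λ alph → length (filter hasPeaks (filter unique? (words alph k)))) (sym (map-relabel as↑ |as|≡|bs|)) ⟩
  length (filter hasPeaks (filter unique? (words (map f as) k)))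
    ≡⟨ cong (λ ws → length (filter hasPeaks (filter unique? ws))) (words-map f as k) ⟩
  length (filter hasPeaks (filter unique? (map (map f) (words as k))))
    ≡⟨ cong (length ∘ filter hasPeaks) (filter-map unique? unique? (map f) _ (unique⇔ ∘ proj₂ ∘ ∈-words⁻ k)) ⟩
  length (filter hasPeaks (map (map f) (filter unique? (words as k))))
    ≡⟨ cong length (filter-map hasPeaks hasPeaks (map f) _
                               (peakSet⇔ ∘ proj₂ ∘ ∈-words⁻ k ∘ proj₁ ∘ ∈-filter⁻ unique?)) ⟩
  length (map (map f) (filter hasPeaks (filter unique? (words as k))))
    ≡⟨ List.length-map (map f) (filter hasPeaks (filter unique? (words as k))) ⟩
  length (filter hasPeaks (filter unique? (words as k))) ∎
  where
  open ≡-Reasoning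
  f = relabel as bs
  hasPeaks = hasPeakSet? S
  unique? = UniqueDec.unique? ℤP._≟_
  unique⇔ : ∀ {w} → All (_∈ as) w → Unique (map f w) ⇔ Unique w
  unique⇔ w⊆ = mk⇔ Unique.map⁻ (unique-map⁺ (relabel-≢ as↑ bs↑ |as|≡|bs|) w⊆)
  peakSet⇔ : ∀ {w} → All (_∈ as) w → peakSet (map f w) ≡ S ⇔ peakSet w ≡ S
  peakSet⇔ w⊆ rewrite peaksFrom-map f (relabel-<⇔ as↑ bs↑ |as|≡|bs|) 1 w⊆ = mk⇔ id id

-- Signed alphabets

∈-pos⁻ : ∀ n {x} → x ∈ pos n → ∃[ i ] (i < n × x ≡ ℤ.+ suc i)
∈-pos⁻ n x∈ with i , i∈ , refl ← ∈-map⁻ (ℤ.+_ ∘ suc) x∈ = i , ∈-upTo⁻ i∈ , refl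

∈-pos⁺ : ∀ n {i} → i < n → ℤ.+ suc i ∈ pos n
∈-pos⁺ n i<n = ∈-map⁺ (ℤ.+_ ∘ suc) (∈-upTo⁺ i<n)

neg++pos-unique : ∀ n → Unique (neg n ++ pos n)
neg++pos-unique n = Unique.++⁺ (Unique.map⁺ ℤP.-[1+-injective (Unique.upTo⁺ n))
                               (Unique.map⁺ (ℕP.suc-injective ∘ ℤP.+-injective) (Unique.upTo⁺ n)) disjoint
  where
  disjoint : ∀ {x} → x ∈ neg n × x ∈ pos n → ⊥
  disjoint (x∈neg , x∈pos) with _ , _ , refl ← ∈-map⁻ -[1+_] x∈neg with _ , _ , () ← ∈-map⁻ (ℤ.+_ ∘ suc) x∈pos

pos-sorted : ∀ n → Sorted (pos n)
pos-sorted n = AllPairsP.map⁺ (AllPairsP.applyUpTo⁺₁ id n (λ i<j _ → ℤ.+<+ (s≤s i<j)))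

length-pos : ∀ n → length (pos n) ≡ n
length-pos n = trans (List.length-map _ (upTo n)) (List.length-upTo n)

∈-neg++pos⁻ : ∀ n {x} → x ∈ neg n ++ pos n → ∃[ s ] ∃[ k ] (k < n × x ≡ s ◃ suc k)
∈-neg++pos⁻ n x∈ with ∈-++⁻ (neg n) x∈
... | inj₁ x∈neg with k , k∈ , refl ← ∈-map⁻ -[1+_] x∈neg = Sign.- , k , ∈-upTo⁻ k∈ , refl
... | inj₂ x∈pos with k , k∈ , refl ← ∈-map⁻ (ℤ.+_ ∘ suc) x∈pos = Sign.+ , k , ∈-upTo⁻ k∈ , refl

∈-neg++pos⁺ : ∀ n s {k} → k < n → s ◃ suc k ∈ neg n ++ pos n
∈-neg++pos⁺ n Sign.- k<n = ∈-++⁺ˡ (∈-map⁺ -[1+_] (∈-upTo⁺ k<n))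
∈-neg++pos⁺ n Sign.+ k<n = ∈-++⁺ʳ (neg n) (∈-map⁺ (ℤ.+_ ∘ suc) (∈-upTo⁺ k<n))

-- A sign vector lists the signs of the absolute values n, …, 1 (top first); signAt ε k is the sign of k + 1.
signAt : List Sign → ℕ → Sign
signAt []      k = Sign.+
signAt (s ∷ ε) k = if does (k ℕ.≟ length ε) then s else signAt ε k

signAt-here : ∀ s ε → signAt (s ∷ ε) (length ε) ≡ s
signAt-here s ε rewrite dec-true (length ε ℕ.≟ length ε) refl = refl

signAt-there : ∀ s ε {k} → k ≢ length ε → signAt (s ∷ ε) k ≡ signAt ε k
signAt-there s ε {k} k≢ rewrite dec-false (k ℕ.≟ length ε) k≢ = refl

signAt-applyDownFrom : ∀ (g : ℕ → Sign) n {k} → k < n → signAt (applyDownFrom g n) k ≡ g k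
signAt-applyDownFrom g (suc n) {k} k<1+n with k ℕ.≟ n
... | yes refl = subst (λ m → signAt (g k ∷ applyDownFrom g k) m ≡ g k) (List.length-applyDownFrom g k)
                       (signAt-here (g k) (applyDownFrom g k))
... | no k≢n = trans (signAt-there (g n) (applyDownFrom g n) (k≢n ∘ flip trans (List.length-applyDownFrom g n)))
                     (signAt-applyDownFrom g n (ℕP.≤∧≢⇒< (ℕP.≤-pred k<1+n) k≢n))

applyDownFrom-signAt : ∀ ε → applyDownFrom (signAt ε) (length ε) ≡ ε
applyDownFrom-signAt [] = refl
applyDownFrom-signAt (s ∷ ε) =
  cong₂ _∷_ (signAt-here s ε)
            (trans (applyDownFrom-cong (λ k<|ε| → signAt-there s ε (ℕP.<⇒≢ k<|ε|))) (applyDownFrom-signAt ε))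

signedAlphabet : List Sign → List ℤ
signedAlphabet []           = []
signedAlphabet (Sign.+ ∷ ε) = signedAlphabet ε ++ [ Sign.+ ◃ suc (length ε) ]
signedAlphabet (Sign.- ∷ ε) = (Sign.- ◃ suc (length ε)) ∷ signedAlphabet ε

length-signedAlphabet : ∀ ε → length (signedAlphabet ε) ≡ length ε
length-signedAlphabet [] = refl
length-signedAlphabet (Sign.+ ∷ ε) =
  trans (List.length-++ (signedAlphabet ε)) (trans (ℕP.+-comm _ 1) (cong suc (length-signedAlphabet ε)))
length-signedAlphabet (Sign.- ∷ ε) = cong suc (length-signedAlphabet ε)

∈-signedAlphabet-∷⁻ : ∀ s ε {x} → x ∈ signedAlphabet (s ∷ ε) → x ≡ s ◃ suc (length ε) ⊎ x ∈ signedAlphabet ε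
∈-signedAlphabet-∷⁻ Sign.+ ε x∈ with ∈-++⁻ (signedAlphabet ε) x∈
... | inj₁ x∈ε        = inj₂ x∈ε
... | inj₂ (here x≡) = inj₁ x≡
∈-signedAlphabet-∷⁻ Sign.- ε (here x≡) = inj₁ x≡
∈-signedAlphabet-∷⁻ Sign.- ε (there x∈ε) = inj₂ x∈ε

∈-signedAlphabet-∷⁺ : ∀ s ε {x} → x ≡ s ◃ suc (length ε) ⊎ x ∈ signedAlphabet ε → x ∈ signedAlphabet (s ∷ ε)
∈-signedAlphabet-∷⁺ Sign.+ ε (inj₁ refl) = ∈-++⁺ʳ (signedAlphabet ε) (here refl)
∈-signedAlphabet-∷⁺ Sign.+ ε (inj₂ x∈ε) = ∈-++⁺ˡ x∈ε
∈-signedAlphabet-∷⁺ Sign.- ε (inj₁ refl) = here refl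
∈-signedAlphabet-∷⁺ Sign.- ε (inj₂ x∈ε) = there x∈ε

∈-signedAlphabet⁻ : ∀ ε {x} → x ∈ signedAlphabet ε → ∃[ k ] (k < length ε × x ≡ signAt ε k ◃ suc k)
∈-signedAlphabet⁻ (s ∷ ε) x∈ with ∈-signedAlphabet-∷⁻ s ε x∈
... | inj₁ refl = length ε , ℕP.≤-refl , cong (_◃ suc (length ε)) (sym (signAt-here s ε))
... | inj₂ x∈ε with k , k<|ε| , refl ← ∈-signedAlphabet⁻ ε x∈ε =
  k , ℕP.m≤n⇒m≤1+n k<|ε| , cong (_◃ suc k) (sym (signAt-there s ε (ℕP.<⇒≢ k<|ε|)))

∈-signedAlphabet⁺ : ∀ ε {k} → k < length ε → signAt ε k ◃ suc k ∈ signedAlphabet ε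
∈-signedAlphabet⁺ (s ∷ ε) {k} k<1+|ε| with k ℕ.≟ length ε
... | yes refl = ∈-signedAlphabet-∷⁺ s ε (inj₁ (cong (_◃ suc k) (signAt-here s ε)))
... | no k≢|ε| = ∈-signedAlphabet-∷⁺ s ε (inj₂ (subst (λ t → t ◃ suc k ∈ signedAlphabet ε)
                   (sym (signAt-there s ε k≢|ε|)) (∈-signedAlphabet⁺ ε (ℕP.≤∧≢⇒< (ℕP.≤-pred k<1+|ε|) k≢|ε|))))

∣∣-injective-signedAlphabet : ∀ ε {x y} → x ∈ signedAlphabet ε → y ∈ signedAlphabet ε →
                              ∣ x ∣ ≡ ∣ y ∣ → x ≡ y
∣∣-injective-signedAlphabet ε x∈ y∈ ∣x∣≡∣y∣
  with k , _ , refl ← ∈-signedAlphabet⁻ ε x∈ | j , _ , refl ← ∈-signedAlphabet⁻ ε y∈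
  with refl ← ℕP.suc-injective (trans (sym (ℤP.abs-◃ (signAt ε k) (suc k)))
                                      (trans ∣x∣≡∣y∣ (ℤP.abs-◃ (signAt ε j) (suc j))))
  = refl

signedAlphabet-sorted : ∀ ε → Sorted (signedAlphabet ε)
signedAlphabet-sorted [] = []
signedAlphabet-sorted (Sign.+ ∷ ε) =
  AllPairsP.++⁺ (signedAlphabet-sorted ε) ([] ∷ []) (All.tabulate (λ x∈ε → below (∈-signedAlphabet⁻ ε x∈ε) ∷ []))
  where
  below : ∀ {x} → ∃[ k ] (k < length ε × x ≡ signAt ε k ◃ suc k) → x ℤ.< ℤ.+ suc (length ε)
  below (k , k<|ε| , refl) with signAt ε k
  ... | Sign.+ = ℤ.+<+ (s≤s k<|ε|)
  ... | Sign.- = ℤ.-<+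
signedAlphabet-sorted (Sign.- ∷ ε) =
  All.tabulate (λ x∈ε → above (∈-signedAlphabet⁻ ε x∈ε)) ∷ signedAlphabet-sorted ε
  where
  above : ∀ {x} → ∃[ k ] (k < length ε × x ≡ signAt ε k ◃ suc k) → -[1+ length ε ] ℤ.< x
  above (k , k<|ε| , refl) with signAt ε k
  ... | Sign.+ = ℤ.-<+
  ... | Sign.- = ℤ.-<- k<|ε|

-- Junk value + when w has no letter of absolute value k + 1.
signOf : List ℤ → ℕ → Sign
signOf []      k = Sign.+
signOf (x ∷ w) k = if does (∣ x ∣ ℕ.≟ suc k) then sign x else signOf w k

signs : ℕ → List ℤ → List Sign
signs n w = applyDownFrom (signOf w) n

signOf-∈ : ∀ {w x k} → Unique (map ∣_∣ w) → x ∈ w → ∣ x ∣ ≡ suc k → signOf w k ≡ sign x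
signOf-∈ {x ∷ w} {k = k} _ (here refl) ∣x∣≡ rewrite dec-true (∣ x ∣ ℕ.≟ suc k) ∣x∣≡ = refl
signOf-∈ {z ∷ w} {k = k} (∣z∣∉ ∷ !w) (there x∈w) ∣x∣≡
  rewrite dec-false (∣ z ∣ ℕ.≟ suc k)
                    (λ ∣z∣≡ → All.lookup ∣z∣∉ (∈-map⁺ ∣_∣ x∈w) (trans ∣z∣≡ (sym ∣x∣≡))) =
  signOf-∈ !w x∈w ∣x∣≡

module _ {n : ℕ} {w : List ℤ} where

  signs≡⇒⊆signedAlphabet : ∀ {ε} → Unique (map ∣_∣ w) → All (_∈ neg n ++ pos n) w → signs n w ≡ ε →
                           All (_∈ signedAlphabet ε) w
  signs≡⇒⊆signedAlphabet !∣w∣ w⊆ refl = All.tabulate λ x∈w → inAlphabet x∈w (∈-neg++pos⁻ n (All.lookup w⊆ x∈w))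
    where
    inAlphabet : ∀ {x} → x ∈ w → ∃[ s ] ∃[ k ] (k < n × x ≡ s ◃ suc k) → x ∈ signedAlphabet (signs n w)
    inAlphabet x∈w (s , k , k<n , refl) = subst (λ t → t ◃ suc k ∈ signedAlphabet (signs n w)) signAt≡s
      (∈-signedAlphabet⁺ (signs n w) (subst (k <_) (sym (List.length-applyDownFrom (signOf w) n)) k<n))
      where
      signAt≡s : signAt (signs n w) k ≡ s
      signAt≡s = begin
        signAt (signs n w) k ≡⟨ signAt-applyDownFrom (signOf w) n k<n ⟩
        signOf w k           ≡⟨ signOf-∈ !∣w∣ x∈w (ℤP.abs-◃ s (suc k)) ⟩
        sign (s ◃ suc k)     ≡⟨ ℤP.sign-◃ s (suc k) ⟩
        s                    ∎
        where open ≡-Reasoning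

  module _ (ε : List Sign) (|ε|≡n : length ε ≡ n) (|w|≡n : length w ≡ n)
           (!w : Unique w) (w⊆ : All (_∈ signedAlphabet ε) w) where

    ⊆signedAlphabet⇒∣∣-unique : Unique (map ∣_∣ w)
    ⊆signedAlphabet⇒∣∣-unique = unique-map⁺ (λ x∈ y∈ x≢y → x≢y ∘ ∣∣-injective-signedAlphabet ε x∈ y∈) w⊆ !w

    ⊆signedAlphabet⇒⊆neg++pos : All (_∈ neg n ++ pos n) w
    ⊆signedAlphabet⇒⊆neg++pos = All.map letter w⊆
      where
      letter : ∀ {x} → x ∈ signedAlphabet ε → x ∈ neg n ++ pos n
      letter x∈ with k , k<|ε| , refl ← ∈-signedAlphabet⁻ ε x∈ =
        ∈-neg++pos⁺ n (signAt ε k) (subst (k <_) |ε|≡n k<|ε|)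

    ⊆signedAlphabet⇒signs≡ : signs n w ≡ ε
    ⊆signedAlphabet⇒signs≡ = begin
      applyDownFrom (signOf w) n           ≡⟨ applyDownFrom-cong signOf≡signAt ⟩
      applyDownFrom (signAt ε) n           ≡⟨ cong (applyDownFrom (signAt ε)) (sym |ε|≡n) ⟩
      applyDownFrom (signAt ε) (length ε)  ≡⟨ applyDownFrom-signAt ε ⟩
      ε                                    ∎
      where
      open ≡-Reasoning
      -- w has n distinct letters from an n-letter alphabet, so it uses all of them.
      alphabet⊆w : signedAlphabet ε ⊆ w
      alphabet⊆w = unique-⊆-length≥⇒⊇ ℤP._≟_ !w (All.lookup w⊆)
        (ℕP.≤-reflexive (trans (length-signedAlphabet ε) (trans |ε|≡n (sym |w|≡n))))
      signOf≡signAt : ∀ {k} → k < n → signOf w k ≡ signAt ε k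
      signOf≡signAt {k} k<n =
        trans (signOf-∈ ⊆signedAlphabet⇒∣∣-unique (alphabet⊆w (∈-signedAlphabet⁺ ε (subst (k <_) (sym |ε|≡n) k<n)))
                        (ℤP.abs-◃ (signAt ε k) (suc k)))
              (ℤP.sign-◃ (signAt ε k) (suc k))

module _ (S : List ℕ) (n : ℕ) where

  private
    signedPeakPerms = filter (hasPeakSet? S) (Hyp n)
    ∣∣-unique? = λ (π : List ℤ) → UniqueDec.unique? ℕP._≟_ (map ∣_∣ π)
    unique? = UniqueDec.unique? ℤP._≟_
    signsFibre = λ ε → fibre (signs n) (≡-dec Sign._≟_) ε signedPeakPerms

  signsFibre⊆peakWords : ∀ {ε} → signsFibre ε ⊆ peakWords S (signedAlphabet ε) n
  signsFibre⊆peakWords {ε} w∈ with w∈′ , signs≡ε ← ∈-filter⁻ (λ w → ≡-dec Sign._≟_ (signs n w) ε) w∈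
                          with w∈″ , peaks ← ∈-filter⁻ (hasPeakSet? S) w∈′
                          with w∈‴ , !∣w∣ ← ∈-filter⁻ ∣∣-unique? w∈″
                          with refl , w⊆ ← ∈-words⁻ n w∈‴ =
    ∈-filter⁺ (hasPeakSet? S)
      (∈-filter⁺ unique? (∈-words⁺ (signs≡⇒⊆signedAlphabet !∣w∣ w⊆ signs≡ε)) (Unique.map⁻ !∣w∣))
      peaks

  peakWords⊆signsFibre : ∀ {ε} → length ε ≡ n → peakWords S (signedAlphabet ε) n ⊆ signsFibre ε
  peakWords⊆signsFibre {ε} |ε|≡n w∈ with w∈′ , peaks ← ∈-filter⁻ (hasPeakSet? S) w∈
                               with w∈″ , !w ← ∈-filter⁻ unique? w∈′
                               with |w|≡n , w⊆ ← ∈-words⁻ n w∈″ =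
    ∈-filter⁺ (λ w → ≡-dec Sign._≟_ (signs n w) ε)
      (∈-filter⁺ (hasPeakSet? S)
        (∈-filter⁺ ∣∣-unique?
                   (subst (_ ∈_) (cong (words _) |w|≡n) (∈-words⁺ (⊆signedAlphabet⇒⊆neg++pos ε |ε|≡n |w|≡n !w w⊆)))
                   (⊆signedAlphabet⇒∣∣-unique ε |ε|≡n |w|≡n !w w⊆))
        peaks)
      (⊆signedAlphabet⇒signs≡ ε |ε|≡n |w|≡n !w w⊆)

  #PB≡2^n*#P : #PB S n ≡ 2 ^ n * #P S n
  #PB≡2^n*#P = begin
    length signedPeakPerms      ≡⟨ length≡length*fibre (signs n) (≡-dec Sign._≟_) (words-unique ±-unique n)
                                     signedPeakPerms (All.tabulate λ {w} _ → signs∈ w) (#P S n) length-signsFibre ⟩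
    length (words ± n) * #P S n ≡⟨ cong (_* #P S n) (length-words n) ⟩
    2 ^ n * #P S n              ∎
    where
    open ≡-Reasoning
    ± = Sign.+ ∷ Sign.- ∷ []
    ±-unique : Unique ±
    ±-unique = ((λ ()) ∷ []) ∷ [] ∷ []
    signs∈ : ∀ w → signs n w ∈ words ± n
    signs∈ w = subst (signs n w ∈_) (cong (words ±) (List.length-applyDownFrom (signOf w) n))
                     (∈-words⁺ (All.universal (λ { Sign.+ → here refl ; Sign.- → there (here refl) }) (signs n w)))
    length-signsFibre : ∀ {ε} → ε ∈ words ± n → length (signsFibre ε) ≡ #P S n
    length-signsFibre {ε} ε∈ = trans
      (ℕP.≤-antisym (unique-⊆⇒length≤ fibre-unique signsFibre⊆peakWords)
                    (unique-⊆⇒length≤ peakWords-unique (peakWords⊆signsFibre |ε|≡n)))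
      (length-peakWords-relabel S (pos-sorted n) (signedAlphabet-sorted ε)
                                (trans (length-pos n) (sym (trans (length-signedAlphabet ε) |ε|≡n))) n)
      where
      |ε|≡n = proj₁ (∈-words⁻ n ε∈)
      fibre-unique : Unique (signsFibre ε)
      fibre-unique = Unique.filter⁺ _ (Unique.filter⁺ _ (Unique.filter⁺ _ (words-unique (neg++pos-unique n) n)))
      peakWords-unique : Unique (peakWords S (signedAlphabet ε) n)
      peakWords-unique = Unique.filter⁺ _ (Unique.filter⁺ _
        (words-unique (AllPairs.map (ℤP.<⇒≢) (signedAlphabet-sorted ε)) n))

peakWords-∷ʳ-max : ∀ S n {w} → w ∈ peakWords S (pos n) n → w ++ [ ℤ.+ suc n ] ∈ peakWords S (pos (suc n)) (suc n)
peakWords-∷ʳ-max S n {w} w∈ with w∈′ , peaks ← ∈-filter⁻ (hasPeakSet? S) w∈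
                            with w∈″ , !w ← ∈-filter⁻ (UniqueDec.unique? ℤP._≟_) w∈′
                            with |w|≡n , w⊆ ← ∈-words⁻ n w∈″ =
  ∈-filter⁺ (hasPeakSet? S)
    (∈-filter⁺ (UniqueDec.unique? ℤP._≟_)
      (subst (λ k → w ++ [ ℤ.+ suc n ] ∈ words (pos (suc n)) k)
             (trans (List.length-++ w) (trans (ℕP.+-comm (length w) 1) (cong suc |w|≡n)))
             (∈-words⁺ (AllP.++⁺ (All.map weaken w⊆) (∈-pos⁺ (suc n) ℕP.≤-refl ∷ []))))
      (Unique.++⁺ !w ([] ∷ []) λ { (x∈w , here refl) → ℤP.<-irrefl refl (below (All.lookup w⊆ x∈w)) }))
    (trans (peaksFrom-∷ʳ-max _ 1 w (All.map below w⊆)) peaks)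
  where
  below : ∀ {x} → x ∈ pos n → x ℤ.< ℤ.+ suc n
  below x∈ with i , i<n , refl ← ∈-pos⁻ n x∈ = ℤ.+<+ (s≤s i<n)
  weaken : ∀ {x} → x ∈ pos n → x ∈ pos (suc n)
  weaken x∈ with i , i<n , refl ← ∈-pos⁻ n x∈ = ∈-pos⁺ (suc n) (ℕP.m≤n⇒m≤1+n i<n)

#P≢0⇒#PB≢0 : ∀ S n → #P S n ≢ 0 → #PB S n ≢ 0
#P≢0⇒#PB≢0 S n #P≢0 #PB≡0 with ℕP.m*n≡0⇒m≡0∨n≡0 (2 ^ n) (trans (sym (#PB≡2^n*#P S n)) #PB≡0)
... | inj₁ 2^n≡0 = contradiction (ℕP.m^n≡0⇒m≡0 2 n 2^n≡0) λ ()
... | inj₂ #P≡0  = #P≢0 #P≡0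

#PB≢0⇒#P≢0 : ∀ S n → #PB S n ≢ 0 → #P S n ≢ 0
#PB≢0⇒#P≢0 S n #PB≢0 #P≡0 = #PB≢0 (trans (#PB≡2^n*#P S n) (trans (cong (2 ^ n *_) #P≡0) (ℕP.*-zeroʳ (2 ^ n))))

nAdmissible-suc : ∀ S n → nAdmissible S n → nAdmissible S (suc n)
nAdmissible-suc S n (_ , #PB≢0) =
  s≤s z≤n ,
  #P≢0⇒#PB≢0 S (suc n) (length≢0-map⊆ (_++ [ ℤ.+ suc n ]) (peakWords-∷ʳ-max S n) (#PB≢0⇒#P≢0 S n #PB≢0))

nAdmissible-mono : ∀ S {m n} → m ≤ n → nAdmissible S m → nAdmissible S n
nAdmissible-mono S m≤n = go (ℕP.≤⇒≤′ m≤n)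
  where
  go : ∀ {m n} → m ℕ.≤′ n → nAdmissible S m → nAdmissible S n
  go ℕ.≤′-refl       = id
  go (ℕ.≤′-step m≤′n) = nAdmissible-suc S _ ∘ go m≤′n

-- Polynomials agreeing at all large integers

toℚ-injective : ∀ {m n} → toℚ m ≡ toℚ n → m ≡ n
toℚ-injective {m} {n} eq
  with ℚᵘ.*≡* m*1≡n*1 ← ℚP./-injective-≃ (ℚᵘ.mkℚᵘ (ℤ.+ m) 0) (ℚᵘ.mkℚᵘ (ℤ.+ n) 0) eq =
  ℤP.+-injective (trans (sym (ℤP.*-identityʳ (ℤ.+ m))) (trans m*1≡n*1 (ℤP.*-identityʳ (ℤ.+ n))))

toℚ-* : ∀ m n → toℚ (m * n) ≡ toℚ m ℚ.* toℚ n
toℚ-* m n = ℚP.toℚᵘ-injective (begin-equality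
  ℚ.toℚᵘ (toℚ (m * n))
    ≃⟨ ℚP.toℚᵘ-fromℚᵘ [m*n] ⟩
  [m*n]
    ≃⟨ ℚᵘ.*≡* (cong (ℤ._* ℤ.+ 1) (ℤP.pos-* m n)) ⟩
  [m] ℚᵘ.* [n]
    ≃⟨ ℚᵘP.*-cong (ℚᵘP.≃-sym (ℚP.toℚᵘ-fromℚᵘ [m])) (ℚᵘP.≃-sym (ℚP.toℚᵘ-fromℚᵘ [n])) ⟩
  ℚ.toℚᵘ (toℚ m) ℚᵘ.* ℚ.toℚᵘ (toℚ n)
    ≃⟨ ℚᵘP.≃-sym (ℚP.toℚᵘ-homo-* (toℚ m) (toℚ n)) ⟩
  ℚ.toℚᵘ (toℚ m ℚ.* toℚ n) ∎)
  where
  open ℚᵘP.≤-Reasoning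
  [m*n] = ℚᵘ.mkℚᵘ (ℤ.+ (m * n)) 0
  [m]   = ℚᵘ.mkℚᵘ (ℤ.+ m) 0
  [n]   = ℚᵘ.mkℚᵘ (ℤ.+ n) 0

toℚ-2^n≢0 : ∀ n → toℚ (2 ^ n) ≢ 0ℚ
toℚ-2^n≢0 n 2^n≡0 = contradiction (ℕP.m^n≡0⇒m≡0 2 n (toℚ-injective 2^n≡0)) λ ()

*-cancelˡ-≢0 : ∀ {a b c} → c ≢ 0ℚ → c ℚ.* a ≡ c ℚ.* b → a ≡ b
*-cancelˡ-≢0 {a} {b} {c} c≢0 ca≡cb = begin
  a                     ≡⟨ sym (cancel a) ⟩
  1/ c ℚ.* (c ℚ.* a)    ≡⟨ cong (1/ c ℚ.*_) ca≡cb ⟩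
  1/ c ℚ.* (c ℚ.* b)    ≡⟨ cancel b ⟩
  b                     ∎
  where
  open ≡-Reasoning
  instance _ = ℚ.≢-nonZero c≢0
  cancel : ∀ x → 1/ c ℚ.* (c ℚ.* x) ≡ x
  cancel x = trans (sym (ℚP.*-assoc (1/ c) c x)) (trans (cong (ℚ._* x) (ℚP.*-inverseˡ c)) (ℚP.*-identityˡ x))

open +-*-Solver

subtract : Poly → Poly → Poly
subtract []       []       = []
subtract (c ∷ cs) []       = c ∷ subtract cs []
subtract []       (d ∷ ds) = ℚ.- d ∷ subtract [] ds
subtract (c ∷ cs) (d ∷ ds) = c ℚ.- d ∷ subtract cs ds

eval-subtract : ∀ p q x → eval (subtract p q) x ≡ eval p x ℚ.- eval q x
eval-subtract []       []       x = refl
eval-subtract (c ∷ cs) []       x = trans (cong (λ t → c ℚ.+ x ℚ.* t) (eval-subtract cs [] x))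
  (solve 3 (λ c x u → c :+ x :* (u :- con 0ℚ) := c :+ x :* u :- con 0ℚ) refl c x (eval cs x))
eval-subtract []       (d ∷ ds) x = trans (cong (λ t → ℚ.- d ℚ.+ x ℚ.* t) (eval-subtract [] ds x))
  (solve 3 (λ d x v → :- d :+ x :* (con 0ℚ :- v) := con 0ℚ :- (d :+ x :* v)) refl d x (eval ds x))
eval-subtract (c ∷ cs) (d ∷ ds) x = trans (cong (λ t → c ℚ.- d ℚ.+ x ℚ.* t) (eval-subtract cs ds x))
  (solve 5 (λ c d x u v → (c :- d) :+ x :* (u :- v) := (c :+ x :* u) :- (d :+ x :* v))
           refl c d x (eval cs x) (eval ds x))

-- Synthetic division by x − a: the coefficients of the quotient are the values at a of the tails of p.
syntheticQuotient : ℚ → Poly → Poly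
syntheticQuotient a []           = []
syntheticQuotient a (c ∷ [])     = []
syntheticQuotient a (c ∷ d ∷ ds) = eval (d ∷ ds) a ∷ syntheticQuotient a (d ∷ ds)

length-syntheticQuotient : ∀ a c cs → length (syntheticQuotient a (c ∷ cs)) ≡ length cs
length-syntheticQuotient a c []       = refl
length-syntheticQuotient a c (d ∷ ds) = cong suc (length-syntheticQuotient a d ds)

eval-syntheticQuotient : ∀ a p x → eval p x ≡ (x ℚ.- a) ℚ.* eval (syntheticQuotient a p) x ℚ.+ eval p a
eval-syntheticQuotient a [] x = solve 2 (λ x a → con 0ℚ := (x :- a) :* con 0ℚ :+ con 0ℚ) refl x a
eval-syntheticQuotient a (c ∷ []) x =
  solve 3 (λ c x a → c :+ x :* con 0ℚ := (x :- a) :* con 0ℚ :+ (c :+ a :* con 0ℚ)) refl c x a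
eval-syntheticQuotient a (c ∷ d ∷ ds) x = begin
  c ℚ.+ x ℚ.* eval (d ∷ ds) x
    ≡⟨ cong (λ t → c ℚ.+ x ℚ.* t) (eval-syntheticQuotient a (d ∷ ds) x) ⟩
  c ℚ.+ x ℚ.* ((x ℚ.- a) ℚ.* q ℚ.+ e)
    ≡⟨ solve 5 (λ c x a q e → c :+ x :* ((x :- a) :* q :+ e) := (x :- a) :* (e :+ x :* q) :+ (c :+ a :* e))
               refl c x a q e ⟩
  (x ℚ.- a) ℚ.* (e ℚ.+ x ℚ.* q) ℚ.+ (c ℚ.+ a ℚ.* e) ∎
  where
  open ≡-Reasoning
  q = eval (syntheticQuotient a (d ∷ ds)) x
  e = eval (d ∷ ds) a

-- Dividing by x − N leaves a quotient of smaller degree that vanishes from N + 1 on.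
private
  vanishes : ∀ k p → length p ≡ k → ∀ N → (∀ n → N ≤ n → eval p (toℚ n) ≡ 0ℚ) → ∀ x → eval p x ≡ 0ℚ
  vanishes _       []       _       _ _     _ = refl
  vanishes (suc k) (c ∷ cs) |p|≡1+k N p[n]≡0 x = begin
    eval p x
      ≡⟨ eval-syntheticQuotient a p x ⟩
    (x ℚ.- a) ℚ.* eval q x ℚ.+ eval p a
      ≡⟨ cong₂ (λ u v → (x ℚ.- a) ℚ.* u ℚ.+ v) (vanishes k q |q|≡k (suc N) q[n]≡0 x) (p[n]≡0 N ℕP.≤-refl) ⟩
    (x ℚ.- a) ℚ.* 0ℚ ℚ.+ 0ℚ
      ≡⟨ solve 2 (λ x a → (x :- a) :* con 0ℚ :+ con 0ℚ := con 0ℚ) refl x a ⟩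
    0ℚ ∎
    where
    open ≡-Reasoning
    p = c ∷ cs
    a = toℚ N
    q = syntheticQuotient a p
    |q|≡k = trans (length-syntheticQuotient a c cs) (ℕP.suc-injective |p|≡1+k)
    q[n]≡0 : ∀ n → suc N ≤ n → eval q (toℚ n) ≡ 0ℚ
    q[n]≡0 n N<n = *-cancelˡ-≢0 n-a≢0 (begin
      (toℚ n ℚ.- a) ℚ.* eval q (toℚ n)
        ≡⟨ solve 2 (λ u v → u := u :+ v :- v) refl _ (eval p a) ⟩
      (toℚ n ℚ.- a) ℚ.* eval q (toℚ n) ℚ.+ eval p a ℚ.- eval p a
        ≡⟨ cong (ℚ._- eval p a) (sym (eval-syntheticQuotient a p (toℚ n))) ⟩
      eval p (toℚ n) ℚ.- eval p a
        ≡⟨ cong₂ ℚ._-_ (p[n]≡0 n (ℕP.<⇒≤ N<n)) (p[n]≡0 N ℕP.≤-refl) ⟩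
      0ℚ ℚ.- 0ℚ
        ≡⟨ solve 1 (λ t → con 0ℚ :- con 0ℚ := t :* con 0ℚ) refl (toℚ n ℚ.- a) ⟩
      (toℚ n ℚ.- a) ℚ.* 0ℚ ∎)
      where
      n-a≢0 : toℚ n ℚ.- a ≢ 0ℚ
      n-a≢0 n-a≡0 = ℕP.<⇒≢ N<n (sym (toℚ-injective (x∙y⁻¹≈ε⇒x≈y (toℚ n) a n-a≡0)))

eval-≡-eventually : ∀ p q N → (∀ n → N ≤ n → eval p (toℚ n) ≡ eval q (toℚ n)) → ∀ x → eval p x ≡ eval q x
eval-≡-eventually p q N p≡q x = x∙y⁻¹≈ε⇒x≈y (eval p x) (eval q x)
  (trans (sym (eval-subtract p q x)) (vanishes _ (subtract p q) refl N p-q≡0 x))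
  where
  p-q≡0 : ∀ n → N ≤ n → eval (subtract p q) (toℚ n) ≡ 0ℚ
  p-q≡0 n N≤n = trans (eval-subtract p q (toℚ n))
                      (trans (cong (ℚ._- eval q (toℚ n)) (p≡q n N≤n)) (ℚP.+-inverseʳ (eval q (toℚ n))))

2*n∸s∸1≡n+[n∸s∸1] : ∀ n s → s < n → 2 * n ∸ s ∸ 1 ≡ n + (n ∸ s ∸ 1)
2*n∸s∸1≡n+[n∸s∸1] n s s<n = begin
  2 * n ∸ s ∸ 1           ≡⟨ ℕP.∸-+-assoc (2 * n) s 1 ⟩
  (n + (n + 0)) ∸ (s + 1) ≡⟨ cong (λ m → (n + m) ∸ (s + 1)) (ℕP.+-identityʳ n) ⟩
  (n + n) ∸ (s + 1)       ≡⟨ ℕP.+-∸-assoc n (subst (_≤ n) (ℕP.+-comm 1 s) s<n) ⟩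
  n + (n ∸ (s + 1))       ≡⟨ cong (n +_) (sym (ℕP.∸-+-assoc n s 1)) ⟩
  n + (n ∸ s ∸ 1)         ∎
  where open ≡-Reasoning

module _ (S : List ℕ) (p pB : Poly)
  (#P≡ : (n : ℕ) → nAdmissible S n → toℚ (#P S n) ≡ eval p (toℚ n) ℚ.* toℚ (2 ^ (n ∸ length S ∸ 1)))
  (#PB≡ : (n : ℕ) → nAdmissible S n → toℚ (#PB S n) ≡ eval pB (toℚ n) ℚ.* toℚ (2 ^ (2 * n ∸ length S ∸ 1)))
  where

  eval-≡-admissible : ∀ n → length S < n → nAdmissible S n → eval p (toℚ n) ≡ eval pB (toℚ n)
  eval-≡-admissible n s<n adm = *-cancelˡ-≢0 (toℚ-2^n≢0 (n + e)) (begin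
    toℚ (2 ^ (n + e)) ℚ.* P
      ≡⟨ cong (ℚ._* P) (trans (cong toℚ (ℕP.^-distribˡ-+-* 2 n e)) (toℚ-* (2 ^ n) (2 ^ e))) ⟩
    T ℚ.* E ℚ.* P
      ≡⟨ solve 3 (λ T E P → T :* E :* P := T :* (P :* E)) refl T E P ⟩
    T ℚ.* (P ℚ.* E)
      ≡⟨ cong (T ℚ.*_) (sym (#P≡ n adm)) ⟩
    T ℚ.* toℚ (#P S n)
      ≡⟨ sym (toℚ-* (2 ^ n) (#P S n)) ⟩
    toℚ (2 ^ n * #P S n)
      ≡⟨ cong toℚ (sym (#PB≡2^n*#P S n)) ⟩
    toℚ (#PB S n)
      ≡⟨ #PB≡ n adm ⟩
    B ℚ.* toℚ (2 ^ (2 * n ∸ length S ∸ 1))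
      ≡⟨ cong (λ k → B ℚ.* toℚ (2 ^ k)) (2*n∸s∸1≡n+[n∸s∸1] n (length S) s<n) ⟩
    B ℚ.* toℚ (2 ^ (n + e))
      ≡⟨ ℚP.*-comm B _ ⟩
    toℚ (2 ^ (n + e)) ℚ.* B ∎)
    where
    open ≡-Reasoning
    e = n ∸ length S ∸ 1
    P = eval p (toℚ n)
    B = eval pB (toℚ n)
    T = toℚ (2 ^ n)
    E = toℚ (2 ^ e)

theorem2p7 : (S : List ℕ) → Admissible S → (p pB : Poly)
    → ((n : ℕ) → nAdmissible S n → toℚ (#P S n) ≡ eval p (toℚ n) ℚ.* toℚ (2 ^ (n ∸ length S ∸ 1)))
    → ((n : ℕ) → nAdmissible S n → toℚ (#PB S n) ≡ eval pB (toℚ n) ℚ.* toℚ (2 ^ (2 * n ∸ length S ∸ 1)))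
    → (x : ℚ) → eval p x ≡ eval pB x
theorem2p7 S (n₀ , adm₀) p pB #P≡ #PB≡ = eval-≡-eventually p pB (n₀ + suc (length S)) λ n n₀+s<n →
  eval-≡-admissible S p pB #P≡ #PB≡ n
    (ℕP.≤-trans (ℕP.m≤n+m (suc (length S)) n₀) n₀+s<n)
    (nAdmissible-mono S (ℕP.≤-trans (ℕP.m≤m+n n₀ (suc (length S))) n₀+s<n) adm₀)
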